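{- Let $\pi=\alpha\oplus(1\ominus\beta)\in\mathrm{Av}(231)$, with $\alpha,\beta\in\mathrm{Av}(231)$, be such that $P$ restricts to a bijection from $\mathrm{Av}(231,\pi)$ onto $\mathrm{Av}(132,P(\pi))$. Then $\alpha$ begins with its maximum.
   Context: Patterns. - $\mathrm{Av}(B)$ is the set of permutations avoiding every pattern in $B$. Sums and the bijection $P$. - $\alpha\oplus\beta=\alpha(\beta+|\alpha|)$ and $\alpha\ominus\beta=(\alpha+|\beta|)\beta$. - Every nonempty $\pi\in\mathrm{Av}(231)$ is uniquely $\alpha\oplus(1\ominus\beta)$ with $\alpha,\beta\in\mathrm{Av}(231)$, possibly empty. - $P:\mathrm{Av}(231)\to\mathrm{Av}(132)$ is the bijection defined by $P(\varepsilon)=\varepsilon$ and $P(\alpha\oplus(1\ominus\beta))=(P(\alpha)\oplus1)\ominus P(\beta)$. - "$P$ restricts to a bijection from $\mathrm{Av}(231,\pi)$ onto $\mathrm{Av}(132,P(\pi))$" means $P(\mathrm{Av}(231,\pi))=\mathrm{Av}(132,P(\pi))$. -}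

module Defs where

open import Data.Nat using (ℕ; zero; suc; _+_; _∸_; _⊔_; _<ᵇ_; _≡ᵇ_; _≤_)
open import Data.Bool using (not)
open import Data.List using (List; []; _∷_; _++_; map; length; upTo; filterᵇ; takeWhileᵇ; dropWhileᵇ; foldr; drop)
open import Data.List.Relation.Binary.Sublist.Propositional using (_⊆_)
open import Data.List.Relation.Binary.Permutation.Propositional using (_↭_)
open import Data.List.Relation.Unary.All using (All)
open import Data.Product using (Σ; ∃; _×_)
open import Data.Sum using (_⊎_)
open import Relation.Nullary using (¬_)
open import Relation.Binary.PropositionalEquality using (_≡_)

-- Permutations in one-line notation: lists of naturals that are a
-- rearrangement of 1,2,...,n where n is the length.
IsPerm : List ℕ → Set
IsPerm xs = xs ↭ map suc (upTo (length xs))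

std : List ℕ → List ℕ
std xs = map (λ x → suc (length (filterᵇ (λ y → y <ᵇ x) xs))) xs

Contains : List ℕ → List ℕ → Set
Contains σ π = ∃ λ s → (s ⊆ π) × (std s ≡ σ)

Av : List (List ℕ) → List ℕ → Set
Av B π = IsPerm π × All (λ σ → ¬ Contains σ π) B

p231 p132 : List ℕ
p231 = 2 ∷ 3 ∷ 1 ∷ []
p132 = 1 ∷ 3 ∷ 2 ∷ []

_⊕_ : List ℕ → List ℕ → List ℕ
α ⊕ β = α ++ map (_+ length α) β

_⊖_ : List ℕ → List ℕ → List ℕ
α ⊖ β = map (_+ length β) α ++ β

infixl 6 _⊕_ _⊖_

maxL : List ℕ → ℕ
maxL = foldr _⊔_ 0

-- The bijection P.  For nonempty π = α ⊕ (1 ⊖ β) ∈ Av(231), the maximum n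
-- sits right after α; α is the prefix before the maximum, and β is the
-- suffix after it with |α| subtracted from each entry.
-- P(ε) = ε,  P(α ⊕ (1 ⊖ β)) = (P(α) ⊕ 1) ⊖ P(β).
-- Fuel = length guarantees the recursion is complete.
Pf : ℕ → List ℕ → List ℕ
Pf zero    xs = []
Pf (suc f) [] = []
Pf (suc f) xs@(_ ∷ _) =
  let m  = maxL xs
      a  = takeWhileᵇ (λ y → not (y ≡ᵇ m)) xs
      b  = map (_∸ length a) (drop 1 (dropWhileᵇ (λ y → not (y ≡ᵇ m)) xs))
  in (Pf f a ⊕ (1 ∷ [])) ⊖ Pf f b

P : List ℕ → List ℕ
P xs = Pf (length xs) xs

-- "P restricts to a bijection from Av(231,π) onto Av(132,P(π))",
-- i.e. P(Av(231,π)) = Av(132,P(π)) as sets.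
RestrictsToBijection : List ℕ → Set
RestrictsToBijection π =
  (∀ σ → Av (p231 ∷ π ∷ []) σ → Av (p132 ∷ P π ∷ []) (P σ)) ×
  (∀ τ → Av (p132 ∷ P π ∷ []) τ → ∃ λ σ → Av (p231 ∷ π ∷ []) σ × P σ ≡ τ)

-- α begins with its maximum (vacuously true for the empty permutation).
BeginsWithMax : List ℕ → Set
BeginsWithMax α = (α ≡ []) ⊎ (∃ λ m → ∃ λ rest → (α ≡ m ∷ rest) × All (_≤ m) rest)

-- Split α = α₁ ⊕ (1 ⊖ α₂) at its maximum; α begins with its maximum exactly when α₁ is empty.
-- If α₁ is nonempty, σ = α₁ ⊕ (1 ⊖ ((1 ⊖ α₂) ⊕ (1 ⊖ β))) avoids 231 and contains π (delete its
-- maximum).  With A = P α₁, B = P α₂, C = P β one computes P π = (((A ⊕ 1) ⊖ B) ⊕ 1) ⊖ C and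
-- P σ = (A ⊕ 1) ⊖ (((1 ⊖ B) ⊕ 1) ⊖ C).  The maximum of P π has |A| + |B| + 1 smaller entries to
-- its left and |C| to its right; such a "peak" persists in every permutation containing P π, but
-- P σ has none.  So P σ ∈ Av(132, P π), while its only preimage in Av(231) is σ (P is injective
-- there), which contains π: P does not map Av(231, π) onto Av(132, P π).

module Submission where

open import Defs
open import Data.Nat using (ℕ; zero; suc; _+_; _∸_; _<ᵇ_; _≡ᵇ_; _≤_; _<_; z≤n; s≤s; z<s; _<?_; _≤?_)
open import Data.Nat.Properties
open import Data.Bool using (Bool; true; false; not; T)
open import Data.List
  using (List; []; _∷_; _++_; map; length; drop; upTo; applyUpTo; filter; filterᵇ;
         takeWhile; dropWhile; takeWhileᵇ; dropWhileᵇ)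
open import Data.List.Properties
  using (length-++; length-map; map-++; map-cong; map-cong-local; map-applyUpTo; map-id; map-∘; map-injective;
         ++-assoc; ++-identityʳ; ++-conicalʳ; ∷-injective; filter-accept; filter-reject; filter-++; filter-all;
         filter-none; length-filter; takeWhile++dropWhile)
open import Data.List.Relation.Unary.All as All using (All; []; _∷_)
import Data.List.Relation.Unary.All.Properties as All
open import Data.List.Relation.Unary.Any as Any using (Any; here; there)
open import Data.List.Membership.Propositional.Properties using (∈-++⁺ʳ; ∈-∃++)
open import Data.List.Membership.Propositional using (_∈_)
open import Data.List.Relation.Binary.Permutation.Propositional
  using (_↭_; ↭-refl; ↭-sym; module PermutationReasoning; ↭⇒↭ₛ)
open import Data.List.Relation.Binary.Permutation.Propositional.Properties
  using (++⁺; map⁺; ++-comm; All-resp-↭; ↭-length; filter-↭; drop-mid; ∈-resp-↭)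
open import Data.List.Relation.Binary.Sublist.Propositional using (_⊆_; []; _∷_; _∷ʳ_; ⊆-refl; ⊆-trans; from∈)
import Data.List.Relation.Binary.Sublist.Propositional.Properties as Sublist
open import Data.List.Relation.Binary.Sublist.Propositional.Properties
  using (length-mono-≤; filter⁺; All-resp-⊆)
open import Data.List.Relation.Unary.Unique.Propositional using (Unique)
open import Data.List.Relation.Unary.AllPairs using (_∷_)
import Data.List.Relation.Unary.Unique.Propositional.Properties as Unique
import Data.List.Relation.Binary.Permutation.Setoid.Properties as PermSetoid
open import Data.Product using (∃; _×_; _,_; proj₁; proj₂)
open import Data.Sum using (_⊎_; inj₁; inj₂)
open import Data.Empty using (⊥-elim)
open import Function using (_∘_; id; case_of_)
open import Relation.Nullary using (¬_; yes; no)
open import Relation.Unary using (Decidable)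
open import Relation.Nullary.Decidable using (T?)
open import Relation.Binary.PropositionalEquality

below : ℕ → List ℕ → ℕ
below x l = length (filterᵇ (_<ᵇ x) l)

-- std l is definitionally map (rank l) l.
rank : List ℕ → ℕ → ℕ
rank l x = suc (below x l)

below-∷< : ∀ {x y} l → y < x → below x (y ∷ l) ≡ suc (below x l)
below-∷< {x} {y} l y<x = cong length (filter-accept (T? ∘ (_<ᵇ x)) {y} {l} (<⇒<ᵇ y<x))

below-∷≥ : ∀ {x y} l → x ≤ y → below x (y ∷ l) ≡ below x l
below-∷≥ {x} {y} l x≤y = cong length (filter-reject (T? ∘ (_<ᵇ x)) {y} {l} (λ y<x → <⇒≱ (<ᵇ⇒< _ _ y<x) x≤y))

below-++ : ∀ x l m → below x (l ++ m) ≡ below x l + below x m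
below-++ x l m = trans (cong length (filter-++ (T? ∘ (_<ᵇ x)) l m)) (length-++ (filterᵇ (_<ᵇ x) l))

below-≤-length : ∀ x l → below x l ≤ length l
below-≤-length x = length-filter (T? ∘ (_<ᵇ x))

below-all : ∀ {x l} → All (_< x) l → below x l ≡ length l
below-all {x} l<x = cong length (filter-all (T? ∘ (_<ᵇ x)) (All.map <⇒<ᵇ l<x))

below-none : ∀ {x l} → All (x ≤_) l → below x l ≡ 0
below-none {x} x≤l = cong length (filter-none (T? ∘ (_<ᵇ x)) (All.map (λ x≤y y<x → <⇒≱ (<ᵇ⇒< _ _ y<x) x≤y) x≤l))

below-↭ : ∀ x {l m} → l ↭ m → below x l ≡ below x m
below-↭ x l↭m = ↭-length (filter-↭ (T? ∘ (_<ᵇ x)) l↭m)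

below-mono-⊆ : ∀ x {s l} → s ⊆ l → below x s ≤ below x l
below-mono-⊆ x s⊆l = length-mono-≤ (filter⁺ (T? ∘ (_<ᵇ x)) (T? ∘ (_<ᵇ x)) (λ { refl p → p }) s⊆l)

below-mono : ∀ {x y} l → x ≤ y → below x l ≤ below y l
below-mono {x} {y} l x≤y = length-mono-≤ (filter⁺ (T? ∘ (_<ᵇ x)) (T? ∘ (_<ᵇ y))
  (λ { refl z<x → <⇒<ᵇ (<-≤-trans (<ᵇ⇒< _ _ z<x) x≤y) }) (⊆-refl {x = l}))

below-map-≤ : ∀ (f : ℕ → ℕ) {x} → (∀ {y} → f y < f x → y < x) → ∀ l → below (f x) (map f l) ≤ below x l
below-map-≤ f reflects [] = z≤n
below-map-≤ f {x} reflects (y ∷ l) with f y <? f x | y <? x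
... | yes fy<fx | _ rewrite below-∷< (map f l) fy<fx | below-∷< l (reflects fy<fx) =
  s≤s (below-map-≤ f reflects l)
... | no fy≮fx | yes y<x rewrite below-∷≥ (map f l) (≮⇒≥ fy≮fx) | below-∷< l y<x =
  m≤n⇒m≤1+n (below-map-≤ f reflects l)
... | no fy≮fx | no y≮x rewrite below-∷≥ (map f l) (≮⇒≥ fy≮fx) | below-∷≥ l (≮⇒≥ y≮x) =
  below-map-≤ f reflects l

below-shift : ∀ k x l → below (x + k) (map (_+ k) l) ≡ below x l
below-shift k x [] = refl
below-shift k x (y ∷ l) with y <? x
... | yes y<x rewrite below-∷< (map (_+ k) l) (+-monoˡ-< k y<x) | below-∷< l y<x = cong suc (below-shift k x l)
... | no y≮x rewrite below-∷≥ (map (_+ k) l) (+-monoˡ-≤ k (≮⇒≥ y≮x)) | below-∷≥ l (≮⇒≥ y≮x) = below-shift k x l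

-- Permutations as rearrangements of intervals

interval : ℕ → ℕ → List ℕ
interval a zero    = []
interval a (suc n) = suc a ∷ interval (suc a) n

applyUpTo-interval : ∀ a n (f : ℕ → ℕ) → (∀ i → f i ≡ suc (a + i)) → applyUpTo f n ≡ interval a n
applyUpTo-interval a zero    f f≗ = refl
applyUpTo-interval a (suc n) f f≗ = cong₂ _∷_ (trans (f≗ 0) (cong suc (+-identityʳ a)))
  (applyUpTo-interval (suc a) n (f ∘ suc) (λ i → trans (f≗ (suc i)) (cong suc (+-suc a i))))

upTo-interval : ∀ n → map suc (upTo n) ≡ interval 0 n
upTo-interval n = trans (map-applyUpTo id suc n) (applyUpTo-interval 0 n suc (λ _ → refl))

length-interval : ∀ a n → length (interval a n) ≡ n
length-interval a zero    = refl
length-interval a (suc n) = cong suc (length-interval (suc a) n)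

interval-shift : ∀ a n k → map (_+ k) (interval a n) ≡ interval (a + k) n
interval-shift a zero    k = refl
interval-shift a (suc n) k = cong (suc (a + k) ∷_) (interval-shift (suc a) n k)

interval-++ : ∀ a m n → interval a (m + n) ≡ interval a m ++ interval (a + m) n
interval-++ a zero    n = cong (λ b → interval b n) (sym (+-identityʳ a))
interval-++ a (suc m) n = cong (suc a ∷_)
  (trans (interval-++ (suc a) m n) (cong (λ b → interval (suc a) m ++ interval b n) (sym (+-suc a m))))

interval-split : ∀ a {m n} → m ≤ n → interval a n ≡ interval a m ++ interval (a + m) (n ∸ m)
interval-split a {m} {n} m≤n = trans (cong (interval a) (sym (m+[n∸m]≡n m≤n))) (interval-++ a m (n ∸ m))

interval-bounds : ∀ a n → All (λ x → a < x × x ≤ a + n) (interval a n)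
interval-bounds a zero    = []
interval-bounds a (suc n) = (≤-refl , ≤-trans (s≤s (m≤m+n a n)) (≤-reflexive (sym (+-suc a n))))
  ∷ All.map (λ (a<x , x≤) → <-trans (n<1+n a) a<x , ≤-trans x≤ (≤-reflexive (sym (+-suc a n))))
            (interval-bounds (suc a) n)

below-interval : ∀ a {k n} → k ≤ n → below (suc (a + k)) (interval a n) ≡ k
below-interval a {k} {n} k≤n = begin
  below x (interval a n)                                          ≡⟨ cong (below x) (interval-split a k≤n) ⟩
  below x (interval a k ++ interval (a + k) (n ∸ k))              ≡⟨ below-++ x (interval a k) _ ⟩
  below x (interval a k) + below x (interval (a + k) (n ∸ k))     ≡⟨ cong₂ _+_ lower upper ⟩
  k + 0                                                           ≡⟨ +-identityʳ k ⟩
  k                                                               ∎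
  where
  open ≡-Reasoning
  x = suc (a + k)
  lower : below x (interval a k) ≡ k
  lower = trans (below-all (All.map (s≤s ∘ proj₂) (interval-bounds a k))) (length-interval a k)
  upper : below x (interval (a + k) (n ∸ k)) ≡ 0
  upper = below-none (All.map proj₁ (interval-bounds (a + k) (n ∸ k)))

unshift-shift : ∀ k l → map (_∸ k) (map (_+ k) l) ≡ l
unshift-shift k l = trans (sym (map-∘ l)) (trans (map-cong (λ x → m+n∸n≡m x k) l) (map-id l))

shift-unshift : ∀ {k l} → All (k ≤_) l → map (_+ k) (map (_∸ k) l) ≡ l
shift-unshift {k} {l} k≤l = trans (sym (map-∘ l)) (trans (map-cong-local (All.map m∸n+n≡m k≤l)) (map-id l))

interval-unshift : ∀ a n → map (_∸ a) (interval a n) ≡ interval 0 n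
interval-unshift a n = trans (cong (map (_∸ a)) (sym (interval-shift 0 n a))) (unshift-shift a (interval 0 n))

toInterval : ∀ {xs} → IsPerm xs → xs ↭ interval 0 (length xs)
toInterval {xs} = subst (xs ↭_) (upTo-interval (length xs))

fromInterval : ∀ {xs n} → xs ↭ interval 0 n → IsPerm xs
fromInterval {xs} xs↭ = subst (xs ↭_) (sym (upTo-interval (length xs)))
  (subst (λ n → xs ↭ interval 0 n) (sym (trans (↭-length xs↭) (length-interval 0 _))) xs↭)

perm-bounds : ∀ {xs} → IsPerm xs → All (λ x → 0 < x × x ≤ length xs) xs
perm-bounds p = All-resp-↭ (↭-sym (toInterval p)) (interval-bounds 0 _)

perm-≤-length : ∀ {xs} → IsPerm xs → All (_≤ length xs) xs
perm-≤-length p = All.map proj₂ (perm-bounds p)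

length-⊕ : ∀ x y → length (x ⊕ y) ≡ length x + length y
length-⊕ x y = trans (length-++ x) (cong (length x +_) (length-map _ y))

length-⊖ : ∀ x y → length (x ⊖ y) ≡ length x + length y
length-⊖ x y = trans (length-++ (map (_+ length y) x)) (cong (_+ length y) (length-map _ x))

⊕-identityˡ : ∀ x → [] ⊕ x ≡ x
⊕-identityˡ x = trans (map-cong +-identityʳ x) (map-id x)

⊕-assoc : ∀ x y z → (x ⊕ y) ⊕ z ≡ x ⊕ (y ⊕ z)
⊕-assoc x y z = begin
  (x ++ map (_+ length x) y) ++ map (_+ length (x ⊕ y)) z
    ≡⟨ ++-assoc x _ _ ⟩
  x ++ map (_+ length x) y ++ map (_+ length (x ⊕ y)) z
    ≡⟨ cong (λ t → x ++ map (_+ length x) y ++ t) shift-twice ⟩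
  x ++ map (_+ length x) y ++ map (_+ length x) (map (_+ length y) z)
    ≡⟨ cong (x ++_) (map-++ (_+ length x) y _) ⟨
  x ++ map (_+ length x) (y ++ map (_+ length y) z)
    ∎
  where
  open ≡-Reasoning
  shift-twice : map (_+ length (x ⊕ y)) z ≡ map (_+ length x) (map (_+ length y) z)
  shift-twice = trans (map-cong (λ v → trans (cong (v +_) (trans (length-⊕ x y) (+-comm (length x) (length y))))
                                             (sym (+-assoc v (length y) (length x)))) z)
                      (map-∘ z)

perm-⊕ : ∀ {x y} → IsPerm x → IsPerm y → IsPerm (x ⊕ y)
perm-⊕ {x} {y} px py = fromInterval (begin
  x ++ map (_+ length x) y
    ↭⟨ ++⁺ (toInterval px) (map⁺ _ (toInterval py)) ⟩
  interval 0 (length x) ++ map (_+ length x) (interval 0 (length y))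
    ≡⟨ cong (interval 0 (length x) ++_) (interval-shift 0 (length y) (length x)) ⟩
  interval 0 (length x) ++ interval (length x) (length y)
    ≡⟨ interval-++ 0 (length x) (length y) ⟨
  interval 0 (length x + length y)
    ∎)
  where open PermutationReasoning

perm-⊖ : ∀ {x y} → IsPerm x → IsPerm y → IsPerm (x ⊖ y)
perm-⊖ {x} {y} px py = fromInterval (begin
  map (_+ length y) x ++ y
    ↭⟨ ++⁺ (map⁺ _ (toInterval px)) (toInterval py) ⟩
  map (_+ length y) (interval 0 (length x)) ++ interval 0 (length y)
    ≡⟨ cong (_++ interval 0 (length y)) (interval-shift 0 (length x) (length y)) ⟩
  interval (length y) (length x) ++ interval 0 (length y)
    ↭⟨ ++-comm (interval (length y) (length x)) _ ⟩
  interval 0 (length y) ++ interval (length y) (length x)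
    ≡⟨ interval-++ 0 (length y) (length x) ⟨
  interval 0 (length y + length x)
    ∎)
  where open PermutationReasoning

perm-1 : IsPerm (1 ∷ [])
perm-1 = ↭-refl

positive : ∀ {xs} → IsPerm xs → All (0 <_) xs
positive p = All.map proj₁ (perm-bounds p)

<-+-shift : ∀ {k x y} → y ≤ k → 0 < x → y < x + k
<-+-shift {k} y≤k 0<x = <-≤-trans (s≤s y≤k) (+-monoˡ-≤ k 0<x)

shifted-above : ∀ {k} {xs ys : List ℕ} → All (0 <_) xs → All (_≤ k) ys → All (λ u → All (_< u) ys) (map (_+ k) xs)
shifted-above 0<xs ys≤k = All.map⁺ (All.map (λ 0<x → All.map (λ y≤k → <-+-shift y≤k 0<x) ys≤k) 0<xs)

shifted-below-top : ∀ {X} (Y : List ℕ) → IsPerm X → All (_< suc (length X) + length Y) (map (_+ length Y) X)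
shifted-below-top Y pX = All.map⁺ (All.map (λ x≤ → s≤s (+-monoˡ-≤ (length Y) x≤)) (perm-≤-length pX))

std-perm : ∀ {π} → IsPerm π → std π ≡ π
std-perm {π} p = trans (map-cong-local (All.map rank-self (perm-bounds p))) (map-id π)
  where
  rank-self : ∀ {x} → 0 < x × x ≤ length π → rank π x ≡ x
  rank-self {suc k} (_ , x≤n) = cong suc (trans (below-↭ (suc k) (toInterval p)) (below-interval 0 (<⇒≤ x≤n)))

⊆-++⁻ : ∀ {s : List ℕ} l m → s ⊆ l ++ m → ∃ λ s₁ → ∃ λ s₂ → s ≡ s₁ ++ s₂ × s₁ ⊆ l × s₂ ⊆ m
⊆-++⁻ []      m s⊆m        = [] , _ , refl , [] , s⊆m
⊆-++⁻ (x ∷ l) m (.x ∷ʳ s⊆) with ⊆-++⁻ l m s⊆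
... | s₁ , s₂ , refl , s₁⊆ , s₂⊆ = s₁ , s₂ , refl , x ∷ʳ s₁⊆ , s₂⊆
⊆-++⁻ (x ∷ l) m (refl ∷ s⊆) with ⊆-++⁻ l m s⊆
... | s₁ , s₂ , refl , s₁⊆ , s₂⊆ = x ∷ s₁ , s₂ , refl , refl ∷ s₁⊆ , s₂⊆

⊆-map⁻ : ∀ {s : List ℕ} (f : ℕ → ℕ) l → s ⊆ map f l → ∃ λ s′ → s ≡ map f s′ × s′ ⊆ l
⊆-map⁻ f []      []           = [] , refl , []
⊆-map⁻ f (x ∷ l) (.(f x) ∷ʳ s⊆) with ⊆-map⁻ f l s⊆
... | s′ , refl , s′⊆ = s′ , refl , x ∷ʳ s′⊆
⊆-map⁻ f (x ∷ l) (refl ∷ s⊆) with ⊆-map⁻ f l s⊆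
... | s′ , refl , s′⊆ = x ∷ s′ , refl , refl ∷ s′⊆

std-shift : ∀ k s → std (map (_+ k) s) ≡ std s
std-shift k s = trans (sym (map-∘ s)) (map-cong (λ x → cong suc (below-shift k x s)) s)

Contains-⊆ : ∀ {σ s l} → s ⊆ l → Contains σ s → Contains σ l
Contains-⊆ s⊆l (t , t⊆s , std-t) = t , ⊆-trans t⊆s s⊆l , std-t

Contains-shift : ∀ {σ} k {l} → Contains σ l → Contains σ (map (_+ k) l)
Contains-shift k (t , t⊆l , std-t) = map (_+ k) t , Sublist.map⁺ (_+ k) t⊆l , trans (std-shift k t) std-t

Has231 Has132 : List ℕ → Set
Has231 l = ∃ λ x → ∃ λ y → ∃ λ z → (x ∷ y ∷ z ∷ []) ⊆ l × z < x × x < y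
Has132 l = ∃ λ x → ∃ λ y → ∃ λ z → (x ∷ y ∷ z ∷ []) ⊆ l × x < z × z < y

rank-reflects-< : ∀ l {x y} → rank l x < rank l y → x < y
rank-reflects-< l {x} {y} rx<ry with x <? y
... | yes x<y = x<y
... | no x≮y  = ⊥-elim (<⇒≱ rx<ry (s≤s (below-mono l (≮⇒≥ x≮y))))

contains231⇒has231 : ∀ {l} → Contains p231 l → Has231 l
contains231⇒has231 (x ∷ y ∷ z ∷ [] , t⊆l , std-t) with ∷-injective std-t
... | rx≡2 , std-yz with ∷-injective std-yz
... | ry≡3 , std-z with ∷-injective std-z
... | rz≡1 , _ = x , y , z , t⊆l ,
  rank-reflects-< (x ∷ y ∷ z ∷ []) (subst₂ _<_ (sym rz≡1) (sym rx≡2) (s≤s (s≤s z≤n))) ,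
  rank-reflects-< (x ∷ y ∷ z ∷ []) (subst₂ _<_ (sym rx≡2) (sym ry≡3) (s≤s (s≤s (s≤s z≤n))))

contains132⇒has132 : ∀ {l} → Contains p132 l → Has132 l
contains132⇒has132 (x ∷ y ∷ z ∷ [] , t⊆l , std-t) with ∷-injective std-t
... | rx≡1 , std-yz with ∷-injective std-yz
... | ry≡3 , std-z with ∷-injective std-z
... | rz≡2 , _ = x , y , z , t⊆l ,
  rank-reflects-< (x ∷ y ∷ z ∷ []) (subst₂ _<_ (sym rx≡1) (sym rz≡2) (s≤s (s≤s z≤n))) ,
  rank-reflects-< (x ∷ y ∷ z ∷ []) (subst₂ _<_ (sym rz≡2) (sym ry≡3) (s≤s (s≤s (s≤s z≤n))))

has231⇒contains231 : ∀ {l} → Has231 l → Contains p231 l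
has231⇒contains231 (x , y , z , t⊆l , z<x , x<y) = x ∷ y ∷ z ∷ [] , t⊆l ,
  cong₂ _∷_ rank-x (cong₂ _∷_ rank-y (cong (_∷ []) rank-z))
  where
  rank-x : rank (x ∷ y ∷ z ∷ []) x ≡ 2
  rank-x rewrite below-∷≥ (y ∷ z ∷ []) (≤-refl {x}) | below-∷≥ (z ∷ []) (<⇒≤ x<y) | below-∷< [] z<x = refl
  rank-y : rank (x ∷ y ∷ z ∷ []) y ≡ 3
  rank-y rewrite below-∷< (y ∷ z ∷ []) x<y | below-∷≥ (z ∷ []) (≤-refl {y}) | below-∷< [] (<-trans z<x x<y) = refl
  rank-z : rank (x ∷ y ∷ z ∷ []) z ≡ 1
  rank-z rewrite below-∷≥ (y ∷ z ∷ []) (<⇒≤ z<x) | below-∷≥ (z ∷ []) (<⇒≤ (<-trans z<x x<y))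
               | below-∷≥ [] (≤-refl {z}) = refl

head-of : ∀ {P : ℕ → Set} {x s l} → x ∷ s ⊆ l → All P l → P x
head-of s⊆l pl = All.head (All-resp-⊆ s⊆l pl)

has231-++ : ∀ U V → All (λ u → All (u <_) V) U → Has231 (U ++ V) → Has231 U ⊎ Has231 V
has231-++ U V U<V (x , y , z , t⊆ , z<x , x<y) with ⊆-++⁻ U V t⊆
... | [] , _ , refl , _ , s₂⊆ = inj₂ (x , y , z , s₂⊆ , z<x , x<y)
... | x ∷ [] , _ , refl , s₁⊆ , s₂⊆ = ⊥-elim (<-asym z<x (head-of (Sublist.∷ˡ⁻ s₂⊆) (head-of s₁⊆ U<V)))
... | x ∷ y ∷ [] , _ , refl , s₁⊆ , s₂⊆ = ⊥-elim (<-asym z<x (head-of s₂⊆ (head-of s₁⊆ U<V)))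
... | x ∷ y ∷ z ∷ [] , [] , refl , s₁⊆ , _ = inj₁ (x , y , z , s₁⊆ , z<x , x<y)
... | x ∷ y ∷ z ∷ [] , _ ∷ _ , () , _ , _
... | x ∷ y ∷ z ∷ _ ∷ _ , _ , () , _ , _

has132-++ : ∀ U V → All (λ u → All (_< u) V) U → Has132 (U ++ V) → Has132 U ⊎ Has132 V
has132-++ U V V<U (x , y , z , t⊆ , x<z , z<y) with ⊆-++⁻ U V t⊆
... | [] , _ , refl , _ , s₂⊆ = inj₂ (x , y , z , s₂⊆ , x<z , z<y)
... | x ∷ [] , _ , refl , s₁⊆ , s₂⊆ = ⊥-elim (<-asym x<z (head-of (Sublist.∷ˡ⁻ s₂⊆) (head-of s₁⊆ V<U)))
... | x ∷ y ∷ [] , _ , refl , s₁⊆ , s₂⊆ = ⊥-elim (<-asym x<z (head-of s₂⊆ (head-of s₁⊆ V<U)))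
... | x ∷ y ∷ z ∷ [] , [] , refl , s₁⊆ , _ = inj₁ (x , y , z , s₁⊆ , x<z , z<y)
... | x ∷ y ∷ z ∷ [] , _ ∷ _ , () , _ , _
... | x ∷ y ∷ z ∷ _ ∷ _ , _ , () , _ , _

has132-∷ʳ-max : ∀ W t → All (_< t) W → Has132 (W ++ t ∷ []) → Has132 W
has132-∷ʳ-max W t W<t (x , y , z , t⊆ , x<z , z<y) with ⊆-++⁻ W (t ∷ []) t⊆
... | x ∷ y ∷ z ∷ [] , [] , refl , s₁⊆ , _ = x , y , z , s₁⊆ , x<z , z<y
... | x ∷ y ∷ [] , z ∷ [] , refl , s₁⊆ , refl ∷ [] = ⊥-elim (<-asym z<y (head-of (Sublist.∷ˡ⁻ s₁⊆) W<t))
... | x ∷ y ∷ [] , z ∷ [] , refl , _ , _ ∷ʳ ()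
... | x ∷ [] , _ ∷ _ ∷ [] , refl , _ , s₂⊆ = ⊥-elim (1+n≰n (length-mono-≤ s₂⊆))
... | [] , _ , refl , _ , s₂⊆ = ⊥-elim (1+n≰n (≤-trans (s≤s (s≤s z≤n)) (length-mono-≤ s₂⊆)))
... | x ∷ y ∷ z ∷ [] , _ ∷ _ , () , _ , _
... | x ∷ y ∷ z ∷ _ ∷ _ , _ , () , _ , _

has231-∷-max : ∀ m l → All (_≤ m) l → Has231 (m ∷ l) → Has231 l
has231-∷-max m l l≤m (x , y , z , .m ∷ʳ t⊆ , z<x , x<y) = x , y , z , t⊆ , z<x , x<y
has231-∷-max m l l≤m (x , y , z , refl ∷ t⊆ , z<x , x<y) = ⊥-elim (<⇒≱ x<y (head-of t⊆ l≤m))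

has231-unshift : ∀ k l → Has231 (map (_+ k) l) → Has231 l
has231-unshift k l (_ , _ , _ , t⊆ , z<x , x<y) with ⊆-map⁻ (_+ k) l t⊆
... | x ∷ y ∷ z ∷ [] , refl , t′⊆ = x , y , z , t′⊆ , +-cancelʳ-< _ _ _ z<x , +-cancelʳ-< _ _ _ x<y

has132-unshift : ∀ k l → Has132 (map (_+ k) l) → Has132 l
has132-unshift k l (_ , _ , _ , t⊆ , x<z , z<y) with ⊆-map⁻ (_+ k) l t⊆
... | x ∷ y ∷ z ∷ [] , refl , t′⊆ = x , y , z , t′⊆ , +-cancelʳ-< _ _ _ x<z , +-cancelʳ-< _ _ _ z<y

maxL-ub : ∀ l → All (_≤ maxL l) l
maxL-ub []      = []
maxL-ub (x ∷ l) = m≤m⊔n x (maxL l) ∷ All.map (λ y≤ → ≤-trans y≤ (m≤n⊔m x (maxL l))) (maxL-ub l)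

maxL-lub : ∀ {m} l → All (_≤ m) l → maxL l ≤ m
maxL-lub []      []           = z≤n
maxL-lub (x ∷ l) (x≤m ∷ l≤m) = ⊔-lub x≤m (maxL-lub l l≤m)

maxL-∈ : ∀ x l → maxL (x ∷ l) ∈ x ∷ l
maxL-∈ x l with ⊔-sel x (maxL l)
... | inj₁ ≡x = here ≡x
maxL-∈ x []      | inj₂ _  = here (⊔-identityʳ x)
maxL-∈ x (y ∷ l) | inj₂ ≡l = there (Any.map (trans ≡l) (maxL-∈ y l))

maxL-split : ∀ {m} a b → All (_< m) a → All (_≤ m) b → maxL (a ++ m ∷ b) ≡ m
maxL-split {m} a b a<m b≤m = ≤-antisym
  (maxL-lub (a ++ m ∷ b) (All.++⁺ (All.map <⇒≤ a<m) (≤-refl ∷ b≤m)))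
  (All.lookup (maxL-ub (a ++ m ∷ b)) (∈-++⁺ʳ a (here refl)))

module _ {P : ℕ → Set} (P? : Decidable P) where

  takeWhile-until : ∀ {m} a b → All P a → ¬ P m → takeWhile P? (a ++ m ∷ b) ≡ a
  takeWhile-until {m} [] b [] ¬Pm with P? m
  ... | yes Pm = ⊥-elim (¬Pm Pm)
  ... | no _   = refl
  takeWhile-until (x ∷ a) b (Px ∷ Pa) ¬Pm with P? x
  ... | yes _  = cong (x ∷_) (takeWhile-until a b Pa ¬Pm)
  ... | no ¬Px = ⊥-elim (¬Px Px)

  dropWhile-until : ∀ {m} a b → All P a → ¬ P m → dropWhile P? (a ++ m ∷ b) ≡ m ∷ b
  dropWhile-until {m} [] b [] ¬Pm with P? m
  ... | yes Pm = ⊥-elim (¬Pm Pm)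
  ... | no _   = refl
  dropWhile-until (x ∷ a) b (Px ∷ Pa) ¬Pm with P? x
  ... | yes _  = dropWhile-until a b Pa ¬Pm
  ... | no ¬Px = ⊥-elim (¬Px Px)

  dropWhile-nonempty : ∀ {l} → Any (¬_ ∘ P) l → ∃ λ z → ∃ λ r → dropWhile P? l ≡ z ∷ r
  dropWhile-nonempty {x ∷ l} any with P? x | any
  ... | no _  | _          = x , l , refl
  ... | yes Px | here ¬Px  = ⊥-elim (¬Px Px)
  ... | yes _ | there any′ = dropWhile-nonempty any′

isNotMax : List ℕ → ℕ → Bool
isNotMax l y = not (y ≡ᵇ maxL l)

beforeMax afterMax : List ℕ → List ℕ
beforeMax l = takeWhileᵇ (isNotMax l) l
afterMax l = map (_∸ length (beforeMax l)) (drop 1 (dropWhileᵇ (isNotMax l) l))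

T-isNotMax : ∀ l {y} → y ≢ maxL l → T (isNotMax l y)
T-isNotMax l {y} y≢m with y ≡ᵇ maxL l in eq
... | false = _
... | true  = y≢m (≡ᵇ⇒≡ y (maxL l) (subst T (sym eq) _))

¬T-isNotMax-max : ∀ l → ¬ T (isNotMax l (maxL l))
¬T-isNotMax-max l t with maxL l ≡ᵇ maxL l | ≡⇒≡ᵇ (maxL l) (maxL l) refl
... | true | _ = t

split-at-max : ∀ y l → ∃ λ z → ∃ λ r →
  y ∷ l ≡ beforeMax (y ∷ l) ++ z ∷ r × afterMax (y ∷ l) ≡ map (_∸ length (beforeMax (y ∷ l))) r
split-at-max y l with dropWhile-nonempty (T? ∘ isNotMax (y ∷ l))
  (Any.map (λ { refl → ¬T-isNotMax-max (y ∷ l) }) (maxL-∈ y l))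
... | z , r , dw≡ = z , r ,
  trans (sym (takeWhile++dropWhile (T? ∘ isNotMax (y ∷ l)) (y ∷ l))) (cong (beforeMax (y ∷ l) ++_) dw≡) ,
  cong (λ d → map (_∸ length (beforeMax (y ∷ l))) (drop 1 d)) dw≡

length-split-at-max : ∀ y l → length (beforeMax (y ∷ l)) + length (afterMax (y ∷ l)) ≡ length l
length-split-at-max y l with split-at-max y l
... | z , r , l≡ , after≡ = begin
  length before + length (afterMax (y ∷ l))  ≡⟨ cong (length before +_) (cong length after≡) ⟩
  length before + length (map _ r)           ≡⟨ cong (length before +_) (length-map _ r) ⟩
  length before + length r                   ≡⟨ suc-injective (begin
    suc (length before + length r)             ≡⟨ +-suc (length before) (length r) ⟨
    length before + length (z ∷ r)             ≡⟨ length-++ before ⟨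
    length (before ++ z ∷ r)                   ≡⟨ cong length l≡ ⟨
    suc (length l)                             ∎) ⟩
  length l                                   ∎
  where
  open ≡-Reasoning
  before = beforeMax (y ∷ l)

beforeMax-shorter : ∀ y l → length (beforeMax (y ∷ l)) ≤ length l
beforeMax-shorter y l = m+n≤o⇒m≤o _ (≤-reflexive (length-split-at-max y l))

afterMax-shorter : ∀ y l → length (afterMax (y ∷ l)) ≤ length l
afterMax-shorter y l = m+n≤o⇒n≤o _ (≤-reflexive (length-split-at-max y l))

Pf-fuel : ∀ f g xs → length xs ≤ f → length xs ≤ g → Pf f xs ≡ Pf g xs
Pf-fuel zero    zero    xs      _         _         = refl
Pf-fuel zero    (suc g) []      _         _         = refl
Pf-fuel (suc f) zero    []      _         _         = refl
Pf-fuel (suc f) (suc g) []      _         _         = refl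
Pf-fuel (suc f) (suc g) (y ∷ l) (s≤s l≤f) (s≤s l≤g) = cong₂ (λ u v → (u ⊕ (1 ∷ [])) ⊖ v)
  (Pf-fuel f g _ (≤-trans (beforeMax-shorter y l) l≤f) (≤-trans (beforeMax-shorter y l) l≤g))
  (Pf-fuel f g _ (≤-trans (afterMax-shorter y l) l≤f) (≤-trans (afterMax-shorter y l) l≤g))

P-unfold : ∀ {xs} → xs ≢ [] → P xs ≡ (P (beforeMax xs) ⊕ (1 ∷ [])) ⊖ P (afterMax xs)
P-unfold {[]}    []≢[] = ⊥-elim ([]≢[] refl)
P-unfold {y ∷ l} _     = cong₂ (λ u v → (u ⊕ (1 ∷ [])) ⊖ v)
  (Pf-fuel (length l) _ _ (beforeMax-shorter y l) ≤-refl) (Pf-fuel (length l) _ _ (afterMax-shorter y l) ≤-refl)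

length-Pf : ∀ f xs → length xs ≤ f → length (Pf f xs) ≡ length xs
length-Pf zero    []      _         = refl
length-Pf (suc f) []      _         = refl
length-Pf (suc f) (y ∷ l) (s≤s l≤f) = begin
  length ((Pf f B ⊕ (1 ∷ [])) ⊖ Pf f A)      ≡⟨ length-⊖ (Pf f B ⊕ (1 ∷ [])) (Pf f A) ⟩
  length (Pf f B ⊕ (1 ∷ [])) + length (Pf f A) ≡⟨ cong (_+ length (Pf f A)) (length-⊕ (Pf f B) (1 ∷ [])) ⟩
  length (Pf f B) + 1 + length (Pf f A)      ≡⟨ cong₂ (λ u v → u + 1 + v)
                                                    (length-Pf f B (≤-trans (beforeMax-shorter y l) l≤f))
                                                    (length-Pf f A (≤-trans (afterMax-shorter y l) l≤f)) ⟩
  length B + 1 + length A                    ≡⟨ cong (_+ length A) (+-comm (length B) 1) ⟩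
  suc (length B + length A)                  ≡⟨ cong suc (length-split-at-max y l) ⟩
  suc (length l)                             ∎
  where
  open ≡-Reasoning
  B = beforeMax (y ∷ l)
  A = afterMax (y ∷ l)

length-P : ∀ xs → length (P xs) ≡ length xs
length-P xs = length-Pf (length xs) xs ≤-refl

perm-Pf : ∀ f xs → IsPerm (Pf f xs)
perm-Pf zero    xs      = ↭-refl
perm-Pf (suc f) []      = ↭-refl
perm-Pf (suc f) (y ∷ l) = perm-⊖ (perm-⊕ (perm-Pf f _) perm-1) (perm-Pf f _)

perm-P : ∀ xs → IsPerm (P xs)
perm-P xs = perm-Pf (length xs) xs

P-split : ∀ {m} a b → All (_< m) a → All (_≤ m) b → P (a ++ m ∷ b) ≡ (P a ⊕ (1 ∷ [])) ⊖ P (map (_∸ length a) b)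
P-split {m} a b a<m b≤m = trans (P-unfold (λ a++m∷b≡[] → case ++-conicalʳ a (m ∷ b) a++m∷b≡[] of λ ()))
  (cong₂ (λ u v → (P u ⊕ (1 ∷ [])) ⊖ P v) before≡ after≡)
  where
  L = a ++ m ∷ b
  max≡ : maxL L ≡ m
  max≡ = maxL-split a b a<m b≤m
  a-notMax : All (T ∘ isNotMax L) a
  a-notMax = All.map (λ x<m → T-isNotMax L (λ x≡ → <⇒≢ x<m (trans x≡ max≡))) a<m
  m-max : ¬ T (isNotMax L m)
  m-max = subst (λ k → ¬ T (isNotMax L k)) max≡ (¬T-isNotMax-max L)
  before≡ : beforeMax L ≡ a
  before≡ = takeWhile-until (T? ∘ isNotMax L) a b a-notMax m-max
  after≡ : afterMax L ≡ map (_∸ length a) b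
  after≡ = cong₂ (λ u d → map (_∸ length u) (drop 1 d)) before≡ (dropWhile-until (T? ∘ isNotMax L) a b a-notMax m-max)

P-⊕[1⊖] : ∀ {a b} → IsPerm a → IsPerm b → P (a ⊕ ((1 ∷ []) ⊖ b)) ≡ (P a ⊕ (1 ∷ [])) ⊖ P b
P-⊕[1⊖] {a} {b} pa pb = trans
  (P-split a (map (_+ length a) b)
    (All.map (λ x≤ → s≤s (≤-trans x≤ (m≤n+m (length a) (length b)))) (perm-≤-length pa))
    (All.map⁺ (All.map (λ y≤ → ≤-trans (+-monoˡ-≤ (length a) y≤) (n≤1+n _)) (perm-≤-length pb))))
  (cong (λ v → (P a ⊕ (1 ∷ [])) ⊖ P v) (unshift-shift (length a) b))

P-1⊖ : ∀ {b} → IsPerm b → P ((1 ∷ []) ⊖ b) ≡ (1 ∷ []) ⊖ P b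
P-1⊖ {b} pb = trans (P-split [] b [] (All.map (λ y≤ → ≤-trans y≤ (n≤1+n _)) (perm-≤-length pb)))
  (cong (λ v → (1 ∷ []) ⊖ P v) (map-id b))

avoids132-[⊕1]⊖ : ∀ {X Y} → IsPerm X → IsPerm Y → ¬ Has132 X → ¬ Has132 Y → ¬ Has132 ((X ⊕ (1 ∷ [])) ⊖ Y)
avoids132-[⊕1]⊖ {X} {Y} pX pY X∌ Y∌ h
  with has132-++ (map (_+ length Y) (X ⊕ (1 ∷ []))) Y
         (shifted-above (positive (perm-⊕ pX perm-1)) (perm-≤-length pY)) h
... | inj₂ inY = Y∌ inY
... | inj₁ inX = X∌ (has132-∷ʳ-max X _ (All.map s≤s (perm-≤-length pX)) (has132-unshift _ _ inX))

Pf-avoids132 : ∀ f xs → ¬ Has132 (Pf f xs)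
Pf-avoids132 zero    xs      (_ , _ , _ , () , _)
Pf-avoids132 (suc f) []      (_ , _ , _ , () , _)
Pf-avoids132 (suc f) (y ∷ l) = avoids132-[⊕1]⊖ (perm-Pf f _) (perm-Pf f _) (Pf-avoids132 f _) (Pf-avoids132 f _)

P-avoids132 : ∀ xs → ¬ Contains p132 (P xs)
P-avoids132 xs = Pf-avoids132 (length xs) xs ∘ contains132⇒has132

-- Sums and decompositions of 231-avoiders

[]∈Av231 : Av (p231 ∷ []) []
[]∈Av231 = ↭-refl , (λ { (.[] , [] , ()) }) ∷ []

Av231-⊕[1⊖] : ∀ {a b} → Av (p231 ∷ []) a → Av (p231 ∷ []) b → Av (p231 ∷ []) (a ⊕ ((1 ∷ []) ⊖ b))
Av231-⊕[1⊖] {a} {b} (pa , a∌ ∷ []) (pb , b∌ ∷ []) = perm-⊕ pa (perm-⊖ perm-1 pb) , avoids ∷ []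
  where
  top = suc (length b) + length a
  a-below : All (λ u → All (u <_) (top ∷ map (_+ length a) b)) a
  a-below = All.map (λ u≤ → s≤s (≤-trans u≤ (m≤n+m _ _)) ∷ All.map⁺ (All.map (<-+-shift u≤) (positive pb)))
                    (perm-≤-length pa)
  avoids : ¬ Contains p231 (a ⊕ ((1 ∷ []) ⊖ b))
  avoids a⊕∋ with has231-++ a (top ∷ map (_+ length a) b) a-below (contains231⇒has231 a⊕∋)
  ... | inj₁ in-a = a∌ (has231⇒contains231 in-a)
  ... | inj₂ in-b = b∌ (has231⇒contains231 (has231-unshift (length a) b (has231-∷-max top _
        (All.map⁺ (All.map (λ y≤ → ≤-trans (+-monoˡ-≤ (length a) y≤) (n≤1+n _)) (perm-≤-length pb))) in-b)))

record Decomposition (σ : List ℕ) : Set where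
  constructor decomposition
  field
    left right : List ℕ
    σ≡         : σ ≡ left ⊕ ((1 ∷ []) ⊖ right)
    left∈Av    : Av (p231 ∷ []) left
    right∈Av   : Av (p231 ∷ []) right

unique-resp-↭ : ∀ {xs ys : List ℕ} → xs ↭ ys → Unique xs → Unique ys
unique-resp-↭ xs↭ys = PermSetoid.Unique-resp-↭ (setoid ℕ) (↭⇒↭ₛ xs↭ys)

interval-unique : ∀ n → Unique (interval 0 n)
interval-unique n = subst Unique (upTo-interval n) (Unique.map⁺ suc-injective (Unique.upTo⁺ n))

unique-++-disjoint : ∀ (a c : List ℕ) → Unique (a ++ c) → All (λ u → All (u ≢_) c) a
unique-++-disjoint []      c _           = []
unique-++-disjoint (x ∷ a) c (x∉ ∷ a++c!) = All.++⁻ʳ a x∉ ∷ unique-++-disjoint a c a++c!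

maxL-< : ∀ {y} l → 0 < y → All (_< y) l → maxL l < y
maxL-< []      0<y []             = 0<y
maxL-< (x ∷ l) 0<y (x<y ∷ l<y) = ⊔-lub x<y (maxL-< l 0<y l<y)

module _ {P : ℕ → Set} (P? : Decidable P) where

  filter-keepˡ : ∀ {a c} → All P a → All (¬_ ∘ P) c → filter P? (a ++ c) ≡ a
  filter-keepˡ {a} {c} Pa ¬Pc = begin
    filter P? (a ++ c)           ≡⟨ filter-++ P? a c ⟩
    filter P? a ++ filter P? c   ≡⟨ cong₂ _++_ (filter-all P? Pa) (filter-none P? ¬Pc) ⟩
    a ++ []                      ≡⟨ ++-identityʳ a ⟩
    a                            ∎
    where open ≡-Reasoning

  filter-keepʳ : ∀ {a c} → All (¬_ ∘ P) a → All P c → filter P? (a ++ c) ≡ c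
  filter-keepʳ {a} {c} ¬Pa Pc =
    trans (filter-++ P? a c) (cong₂ _++_ (filter-none P? ¬Pa) (filter-all P? Pc))

split-perm-at : ∀ {a c n M} → a ++ c ↭ interval 0 n → All (_≤ M) a → All (M <_) c → M ≤ n →
  a ↭ interval 0 M × c ↭ interval M (n ∸ M)
split-perm-at {a} {c} {n} {M} a++c↭ a≤M M<c M≤n =
  subst₂ _↭_ (filter-keepˡ (_≤? M) a≤M (All.map <⇒≱ M<c))
             (filter-keepˡ (_≤? M) (All.map proj₂ low-bounds) (All.map (<⇒≱ ∘ proj₁) high-bounds))
             (filter-↭ (_≤? M) a++c↭′) ,
  subst₂ _↭_ (filter-keepʳ (M <?_) (All.map ≤⇒≯ a≤M) M<c)
             (filter-keepʳ (M <?_) (All.map (≤⇒≯ ∘ proj₂) low-bounds) (All.map proj₁ high-bounds))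
             (filter-↭ (M <?_) a++c↭′)
  where
  a++c↭′ : a ++ c ↭ interval 0 M ++ interval M (n ∸ M)
  a++c↭′ = subst (a ++ c ↭_) (interval-split 0 M≤n) a++c↭
  low-bounds = interval-bounds 0 M
  high-bounds = interval-bounds M (n ∸ M)

left-below-right : ∀ {a c m} → ¬ Contains p231 (a ++ m ∷ c) → All (_< m) a → All (λ u → All (u ≢_) c) a →
  All (λ u → All (u <_) c) a
left-below-right {a} {c} {m} avoids a<m a≢c = All.tabulate (λ u∈a → All.tabulate (λ v∈c → u<v u∈a v∈c))
  where
  u<v : ∀ {u v} → u ∈ a → v ∈ c → u < v
  u<v {u} {v} u∈a v∈c with v <? u
  ... | yes v<u = ⊥-elim (avoids (has231⇒contains231
        (u , m , v , Sublist.++⁺ (from∈ u∈a) (refl ∷ from∈ v∈c) , v<u , All.lookup a<m u∈a)))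
  ... | no v≮u  = ≤∧≢⇒< (≮⇒≥ v≮u) (All.lookup (All.lookup a≢c u∈a) v∈c)

interval-snoc : ∀ n → interval 0 (suc n) ≡ interval 0 n ++ suc n ∷ []
interval-snoc n = trans (cong (interval 0) (+-comm 1 n)) (interval-++ 0 n 1)

split-at-top : ∀ {σ n} → σ ↭ interval 0 (suc n) → ∃ λ a → ∃ λ c → σ ≡ a ++ suc n ∷ c × a ++ c ↭ interval 0 n
split-at-top {σ} {n} σ↭ = split (∈-∃++ (∈-resp-↭ (↭-sym σ↭′) (∈-++⁺ʳ (interval 0 n) (here refl))))
  where
  σ↭′ : σ ↭ interval 0 n ++ suc n ∷ []
  σ↭′ = subst (σ ↭_) (interval-snoc n) σ↭
  split : (∃ λ a → ∃ λ c → σ ≡ a ++ suc n ∷ c) → ∃ λ a → ∃ λ c → σ ≡ a ++ suc n ∷ c × a ++ c ↭ interval 0 n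
  split (a , c , σ≡) = a , c , σ≡ ,
    subst (a ++ c ↭_) (++-identityʳ _) (drop-mid a (interval 0 n) (subst (_↭ _) σ≡ σ↭′))

decompose : ∀ {σ n} → length σ ≡ suc n → Av (p231 ∷ []) σ → Decomposition σ
decompose {σ} {n} |σ|≡ (pσ , avoids ∷ []) with split-at-top (subst (λ k → σ ↭ interval 0 k) |σ|≡ (toInterval pσ))
... | a , c , refl , a++c↭ = decomposition a b σ≡ (fromInterval a↭ , avoids-a ∷ []) (fromInterval b↭ , avoids-b ∷ [])
  where
  bounds = All-resp-↭ (↭-sym a++c↭) (interval-bounds 0 n)
  a-bounds = All.++⁻ˡ a bounds
  c-bounds = All.++⁻ʳ a bounds
  a<c : All (λ u → All (u <_) c) a
  a<c = left-below-right avoids (All.map (s≤s ∘ proj₂) a-bounds)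
    (unique-++-disjoint a c (unique-resp-↭ (↭-sym a++c↭) (interval-unique n)))
  M = maxL a
  M<c : All (M <_) c
  M<c = All.tabulate (λ v∈c → maxL-< a (proj₁ (All.lookup c-bounds v∈c)) (All.map (λ u<c → All.lookup u<c v∈c) a<c))
  M≤n : M ≤ n
  M≤n = maxL-lub a (All.map proj₂ a-bounds)
  a↭ : a ↭ interval 0 M
  a↭ = proj₁ (split-perm-at a++c↭ (maxL-ub a) M<c M≤n)
  b = map (_∸ M) c
  b↭ : b ↭ interval 0 (n ∸ M)
  b↭ = subst (b ↭_) (interval-unshift M (n ∸ M)) (map⁺ _ (proj₂ (split-perm-at a++c↭ (maxL-ub a) M<c M≤n)))
  |a|≡M : length a ≡ M
  |a|≡M = trans (↭-length a↭) (length-interval 0 M)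
  c≡ : c ≡ map (_+ length a) b
  c≡ = sym (trans (cong (λ k → map (_+ k) b) |a|≡M) (shift-unshift (All.map <⇒≤ M<c)))
  σ≡ : a ++ suc n ∷ c ≡ a ⊕ ((1 ∷ []) ⊖ b)
  σ≡ = cong₂ (λ m r → a ++ m ∷ r)
    (cong suc (sym (trans (cong₂ _+_ (trans (↭-length b↭) (length-interval 0 _)) |a|≡M) (m∸n+n≡m M≤n))))
    c≡
  avoids-a : ¬ Contains p231 a
  avoids-a = avoids ∘ Contains-⊆ (Sublist.++⁺ʳ (suc n ∷ c) ⊆-refl)
  avoids-b : ¬ Contains p231 b
  avoids-b = avoids ∘ Contains-⊆ (Sublist.++⁺ˡ a (suc n ∷ʳ ⊆-refl)) ∘ subst (Contains p231) (sym c≡)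
           ∘ Contains-shift (length a)

-- Injectivity of P on Av(231)

[⊕1]⊖-shape : ∀ X Y → (X ⊕ (1 ∷ [])) ⊖ Y ≡ map (_+ length Y) X ++ (suc (length X) + length Y) ∷ Y
[⊕1]⊖-shape X Y =
  trans (cong (_++ Y) (map-++ (_+ length Y) X (suc (length X) ∷ []))) (++-assoc (map (_+ length Y) X) _ Y)

++-cancel-at-max : ∀ {m} xs ys xs′ ys′ → All (_< m) xs → All (_< m) xs′ → xs ++ m ∷ ys ≡ xs′ ++ m ∷ ys′ →
  xs ≡ xs′ × ys ≡ ys′
++-cancel-at-max []       ys []         ys′ _            _            refl = refl , refl
++-cancel-at-max []       ys (x′ ∷ xs′) ys′ _            (m<m ∷ _)    refl = ⊥-elim (<-irrefl refl m<m)
++-cancel-at-max (x ∷ xs) ys []         ys′ (m<m ∷ _)    _            refl = ⊥-elim (<-irrefl refl m<m)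
++-cancel-at-max (x ∷ xs) ys (x′ ∷ xs′) ys′ (_ ∷ xs<m)   (_ ∷ xs′<m)  eq with ∷-injective eq
... | refl , eq′ with ++-cancel-at-max xs ys xs′ ys′ xs<m xs′<m eq′
... | refl , refl = refl , refl

length-⊕[1⊖] : ∀ a b → length (a ⊕ ((1 ∷ []) ⊖ b)) ≡ suc (length a + length b)
length-⊕[1⊖] a b = trans (length-⊕ a ((1 ∷ []) ⊖ b)) (+-suc (length a) (length b))

length-[⊕1]⊖ : ∀ X Y → length ((X ⊕ (1 ∷ [])) ⊖ Y) ≡ suc (length X) + length Y
length-[⊕1]⊖ X Y = trans (length-⊖ (X ⊕ (1 ∷ [])) Y) (cong (_+ length Y) (trans (length-⊕ X _) (+-comm (length X) 1)))

[⊕1]⊖-injective : ∀ {X Y X′ Y′} → IsPerm X → IsPerm X′ → (X ⊕ (1 ∷ [])) ⊖ Y ≡ (X′ ⊕ (1 ∷ [])) ⊖ Y′ → X ≡ X′ × Y ≡ Y′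
[⊕1]⊖-injective {X} {Y} {X′} {Y′} pX pX′ eq =
  map-injective (λ {u} {v} → +-cancelʳ-≡ (length Y′) u v)
    (trans (cong (λ k → map (_+ k) X) (cong length (sym Y≡Y′))) X-parts) ,
  Y≡Y′
  where
  m = suc (length X) + length Y
  m≡ : m ≡ suc (length X′) + length Y′
  m≡ = trans (sym (length-[⊕1]⊖ X Y)) (trans (cong length eq) (length-[⊕1]⊖ X′ Y′))
  parts : map (_+ length Y) X ≡ map (_+ length Y′) X′ × Y ≡ Y′
  parts = ++-cancel-at-max (map (_+ length Y) X) Y (map (_+ length Y′) X′) Y′
    (shifted-below-top Y pX) (subst (λ k → All (_< k) (map (_+ length Y′) X′)) (sym m≡) (shifted-below-top Y′ pX′))
    (trans (sym ([⊕1]⊖-shape X Y)) (trans eq (trans ([⊕1]⊖-shape X′ Y′)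
      (cong (λ k → map (_+ length Y′) X′ ++ k ∷ Y′) (sym m≡)))))
  X-parts = proj₁ parts
  Y≡Y′ = proj₂ parts

P-decomposition : ∀ {σ} (d : Decomposition σ) → let open Decomposition d in
  P σ ≡ (P left ⊕ (1 ∷ [])) ⊖ P right
P-decomposition (decomposition a b refl (pa , _) (pb , _)) = P-⊕[1⊖] pa pb

P-≡⇒length-≡ : ∀ {σ τ} → P σ ≡ P τ → length σ ≡ length τ
P-≡⇒length-≡ {σ} {τ} Pσ≡Pτ = trans (sym (length-P σ)) (trans (cong length Pσ≡Pτ) (length-P τ))

length≡0 : ∀ {l : List ℕ} → length l ≡ 0 → l ≡ []
length≡0 {[]} _ = refl

P-injective-≤ : ∀ k {σ τ} → length σ ≤ k → Av (p231 ∷ []) σ → Av (p231 ∷ []) τ → P σ ≡ P τ → σ ≡ τ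
P-injective-≤ k       {[]}    {τ} _         _  _  Pσ≡Pτ = sym (length≡0 (sym (P-≡⇒length-≡ {[]} {τ} Pσ≡Pτ)))
P-injective-≤ (suc k) {x ∷ l} {τ} (s≤s l≤k) σ∈ τ∈ Pσ≡Pτ
  with decompose refl σ∈ | decompose (sym (P-≡⇒length-≡ {x ∷ l} {τ} Pσ≡Pτ)) τ∈
... | dσ@(decomposition a b σ≡ a∈ b∈) | dτ@(decomposition a′ b′ τ≡ a′∈ b′∈) =
  trans σ≡ (trans (cong₂ (λ u v → u ⊕ ((1 ∷ []) ⊖ v))
    (P-injective-≤ k (m+n≤o⇒m≤o (length a) parts≤k) a∈ a′∈ (proj₁ P-parts))
    (P-injective-≤ k (m+n≤o⇒n≤o (length a) parts≤k) b∈ b′∈ (proj₂ P-parts))) (sym τ≡))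
  where
  P-parts = [⊕1]⊖-injective (perm-P a) (perm-P a′)
    (trans (sym (P-decomposition dσ)) (trans Pσ≡Pτ (P-decomposition dτ)))
  parts≤k : length a + length b ≤ k
  parts≤k = ≤-trans (≤-reflexive (suc-injective (trans (sym (length-⊕[1⊖] a b)) (cong length (sym σ≡))))) l≤k

P-injective : ∀ {σ τ} → Av (p231 ∷ []) σ → Av (p231 ∷ []) τ → P σ ≡ P τ → σ ≡ τ
P-injective {σ} = P-injective-≤ (length σ) ≤-refl

-- Peaks

Peak : List ℕ → ℕ → ℕ → Set
Peak ρ p q = ∃ λ pre → ∃ λ e → ∃ λ post → ρ ≡ pre ++ e ∷ post × p ≤ below e pre × q ≤ below e post

⊆-around : ∀ pre (e : ℕ) post {l} → pre ++ e ∷ post ⊆ l →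
  ∃ λ pre′ → ∃ λ post′ → l ≡ pre′ ++ e ∷ post′ × pre ⊆ pre′ × post ⊆ post′
⊆-around []        e post (y ∷ʳ s⊆) with ⊆-around [] e post s⊆
... | pre′ , post′ , refl , pre⊆ , post⊆ = y ∷ pre′ , post′ , refl , y ∷ʳ pre⊆ , post⊆
⊆-around []        e post (refl ∷ s⊆) = [] , _ , refl , [] , s⊆
⊆-around (x ∷ pre) e post (y ∷ʳ s⊆) with ⊆-around (x ∷ pre) e post s⊆
... | pre′ , post′ , refl , pre⊆ , post⊆ = y ∷ pre′ , post′ , refl , y ∷ʳ pre⊆ , post⊆
⊆-around (x ∷ pre) e post (refl ∷ s⊆) with ⊆-around pre e post s⊆
... | pre′ , post′ , refl , pre⊆ , post⊆ = x ∷ pre′ , post′ , refl , refl ∷ pre⊆ , post⊆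

Peak-⊆ : ∀ {s l p q} → s ⊆ l → Peak s p q → Peak l p q
Peak-⊆ s⊆l (pre , e , post , refl , p≤ , q≤) with ⊆-around pre e post s⊆l
... | pre′ , post′ , refl , pre⊆ , post⊆ =
  pre′ , e , post′ , refl , ≤-trans p≤ (below-mono-⊆ e pre⊆) , ≤-trans q≤ (below-mono-⊆ e post⊆)

map-around : ∀ (f : ℕ → ℕ) s pre e post → map f s ≡ pre ++ e ∷ post →
  ∃ λ pre′ → ∃ λ e′ → ∃ λ post′ → s ≡ pre′ ++ e′ ∷ post′ × map f pre′ ≡ pre × f e′ ≡ e × map f post′ ≡ post
map-around f (x ∷ s) []        e post eq with ∷-injective eq
... | refl , refl = [] , x , s , refl , refl , refl , refl
map-around f (x ∷ s) (y ∷ pre) e post eq with ∷-injective eq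
... | refl , eq′ with map-around f s pre e post eq′
... | pre′ , e′ , post′ , refl , refl , refl , refl = x ∷ pre′ , e′ , post′ , refl , refl , refl , refl

Peak-std : ∀ {s p q} → Peak (std s) p q → Peak s p q
Peak-std {s} (pre , e , post , eq , p≤ , q≤) with map-around (rank s) s pre e post eq
... | pre′ , e′ , post′ , refl , refl , refl , refl = pre′ , e′ , post′ , refl ,
  ≤-trans p≤ (below-map-≤ (rank s) {e′} (rank-reflects-< s) pre′) ,
  ≤-trans q≤ (below-map-≤ (rank s) {e′} (rank-reflects-< s) post′)

Peak-contains : ∀ {π ρ p q} → Contains π ρ → Peak π p q → Peak ρ p q
Peak-contains (s , s⊆ρ , refl) = Peak-⊆ s⊆ρ ∘ Peak-std

++-around : ∀ (U V pre : List ℕ) e post → U ++ V ≡ pre ++ e ∷ post →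
  (∃ λ k → U ≡ pre ++ e ∷ k) ⊎ (∃ λ k → pre ≡ U ++ k × V ≡ k ++ e ∷ post)
++-around []      V pre       e post eq = inj₂ (pre , refl , eq)
++-around (u ∷ U) V []        e post eq with ∷-injective eq
... | refl , _ = inj₁ (U , refl)
++-around (u ∷ U) V (x ∷ pre) e post eq with ∷-injective eq
... | refl , eq′ with ++-around U V pre e post eq′
... | inj₁ (k , refl)      = inj₁ (k , refl)
... | inj₂ (k , refl , V≡) = inj₂ (k , refl , V≡)

Peak-drop-prefix : ∀ U V {p q} → length U ≤ p → All (λ u → All (_≤ u) V) U → Peak (U ++ V) p q → Peak V p q
Peak-drop-prefix U V |U|≤p V≤U (pre , e , post , eq , p≤ , q≤) with ++-around U V pre e post eq
... | inj₁ (k , refl) = ⊥-elim (<⇒≱ (begin-strict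
  below e pre                  ≤⟨ below-≤-length e pre ⟩
  length pre                   <⟨ m<m+n (length pre) z<s ⟩
  length pre + length (e ∷ k)  ≡⟨ length-++ pre ⟨
  length (pre ++ e ∷ k)        ≤⟨ |U|≤p ⟩
  _                            ∎) p≤)
  where open ≤-Reasoning
... | inj₂ (k , refl , refl) = k , e , post , refl ,
  ≤-trans p≤ (≤-reflexive (trans (below-++ e U k)
    (cong (_+ below e k) (below-none (All.map (λ V≤u → All.lookup V≤u (∈-++⁺ʳ k (here refl))) V≤U))))) ,
  q≤

no-Peak-full : ∀ V {p} → ¬ Peak V p (length V)
no-Peak-full V (pre , e , post , refl , _ , q≤) = <⇒≱ (begin-strict
  below e post                   ≤⟨ below-≤-length e post ⟩
  length post                    <⟨ n<1+n (length post) ⟩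
  suc (length post)              ≤⟨ m≤n+m _ (length pre) ⟩
  length pre + suc (length post) ≡⟨ length-++ pre ⟨
  length (pre ++ e ∷ post)       ∎) q≤
  where open ≤-Reasoning

Peak-[⊕1]⊖ : ∀ {Z C} → IsPerm Z → IsPerm C → Peak ((Z ⊕ (1 ∷ [])) ⊖ C) (length Z) (length C)
Peak-[⊕1]⊖ {Z} {C} pZ pC = map (_+ length C) Z , suc (length Z) + length C , C , [⊕1]⊖-shape Z C ,
  ≤-reflexive (sym (trans (below-all (shifted-below-top C pZ)) (length-map _ Z))) ,
  ≤-reflexive (sym (below-all (All.map (λ y≤ → s≤s (≤-trans y≤ (m≤n+m _ _))) (perm-≤-length pC))))

-- A peak with |(A ⊕ 1) ⊖ B| smaller entries on its left cannot sit among the first |A| + 1 entries,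
-- nor among the next |B| + 2 (each block lies above everything after it), so it sits in C.
no-Peak-nested : ∀ {A B C} → 1 ≤ length A → IsPerm A → IsPerm B → IsPerm C →
  ¬ Peak ((A ⊕ (1 ∷ [])) ⊖ ((((1 ∷ []) ⊖ B) ⊕ (1 ∷ [])) ⊖ C)) (length ((A ⊕ (1 ∷ [])) ⊖ B)) (length C)
no-Peak-nested {A} {B} {C} 1≤|A| pA pB pC =
  no-Peak-full C ∘
  Peak-drop-prefix (map (_+ length C) X) C |X|≤p (above pX pC) ∘
  Peak-drop-prefix (map (_+ length W) (A ⊕ (1 ∷ []))) W |A⊕1|≤p (above (perm-⊕ pA perm-1) (perm-⊖ pX pC))
  where
  open ≤-Reasoning
  X = ((1 ∷ []) ⊖ B) ⊕ (1 ∷ [])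
  W = X ⊖ C
  pX : IsPerm X
  pX = perm-⊕ (perm-⊖ perm-1 pB) perm-1
  above : ∀ {U V} → IsPerm U → IsPerm V → All (λ u → All (_≤ u) V) (map (_+ length V) U)
  above pU pV = All.map (All.map <⇒≤) (shifted-above (positive pU) (perm-≤-length pV))
  |A⊕1|≤p : length (map (_+ length W) (A ⊕ (1 ∷ []))) ≤ length ((A ⊕ (1 ∷ [])) ⊖ B)
  |A⊕1|≤p = begin
    length (map (_+ length W) (A ⊕ (1 ∷ [])))  ≡⟨ length-map _ (A ⊕ (1 ∷ [])) ⟩
    length (A ⊕ (1 ∷ []))                       ≤⟨ m≤m+n _ (length B) ⟩
    length (A ⊕ (1 ∷ [])) + length B           ≡⟨ length-⊖ (A ⊕ (1 ∷ [])) B ⟨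
    length ((A ⊕ (1 ∷ [])) ⊖ B)                ∎
  |X|≤p : length (map (_+ length C) X) ≤ length ((A ⊕ (1 ∷ [])) ⊖ B)
  |X|≤p = begin
    length (map (_+ length C) X)  ≡⟨ length-map _ X ⟩
    length X                      ≡⟨ length-⊕ ((1 ∷ []) ⊖ B) (1 ∷ []) ⟩
    suc (length B) + 1            ≡⟨ +-comm (suc (length B)) 1 ⟩
    suc (suc (length B))          ≤⟨ s≤s (+-monoˡ-≤ (length B) 1≤|A|) ⟩
    suc (length A) + length B     ≡⟨ length-[⊕1]⊖ A B ⟨
    length ((A ⊕ (1 ∷ [])) ⊖ B)   ∎

module _ {α₁ α₂ β : List ℕ} (α₁∈ : Av (p231 ∷ []) α₁) (α₂∈ : Av (p231 ∷ []) α₂) (β∈ : Av (p231 ∷ []) β) where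

  private
    π ρ σ A B C : List ℕ
    π = (α₁ ⊕ ((1 ∷ []) ⊖ α₂)) ⊕ ((1 ∷ []) ⊖ β)
    ρ = ((1 ∷ []) ⊖ α₂) ⊕ ((1 ∷ []) ⊖ β)
    σ = α₁ ⊕ ((1 ∷ []) ⊖ ρ)
    A = P α₁
    B = P α₂
    C = P β

    1⊖α₂∈ : Av (p231 ∷ []) ((1 ∷ []) ⊖ α₂)
    1⊖α₂∈ = subst (Av (p231 ∷ [])) (⊕-identityˡ _) (Av231-⊕[1⊖] []∈Av231 α₂∈)

    σ∈ : Av (p231 ∷ []) σ
    σ∈ = Av231-⊕[1⊖] α₁∈ (Av231-⊕[1⊖] 1⊖α₂∈ β∈)

    -- π = α₁ ⊕ ρ is σ with its maximum deleted.
    σ∋π : Contains π σ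
    σ∋π = π , subst (_⊆ σ) (sym (⊕-assoc α₁ _ _)) (Sublist.++⁺ ⊆-refl (_ ∷ʳ ⊆-refl)) ,
          std-perm (proj₁ (Av231-⊕[1⊖] (Av231-⊕[1⊖] α₁∈ α₂∈) β∈))

    Pσ≡ : P σ ≡ (A ⊕ (1 ∷ [])) ⊖ ((((1 ∷ []) ⊖ B) ⊕ (1 ∷ [])) ⊖ C)
    Pσ≡ = begin
      P σ
        ≡⟨ P-⊕[1⊖] (proj₁ α₁∈) (perm-⊕ (proj₁ 1⊖α₂∈) (perm-⊖ perm-1 (proj₁ β∈))) ⟩
      (A ⊕ (1 ∷ [])) ⊖ P ρ
        ≡⟨ cong ((A ⊕ (1 ∷ [])) ⊖_) (P-⊕[1⊖] (proj₁ 1⊖α₂∈) (proj₁ β∈)) ⟩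
      (A ⊕ (1 ∷ [])) ⊖ ((P ((1 ∷ []) ⊖ α₂) ⊕ (1 ∷ [])) ⊖ C)
        ≡⟨ cong (λ t → (A ⊕ (1 ∷ [])) ⊖ ((t ⊕ (1 ∷ [])) ⊖ C)) (P-1⊖ (proj₁ α₂∈)) ⟩
      (A ⊕ (1 ∷ [])) ⊖ ((((1 ∷ []) ⊖ B) ⊕ (1 ∷ [])) ⊖ C)
        ∎
      where open ≡-Reasoning

    Pπ≡ : P π ≡ ((((A ⊕ (1 ∷ [])) ⊖ B) ⊕ (1 ∷ [])) ⊖ C)
    Pπ≡ = trans (P-⊕[1⊖] (proj₁ (Av231-⊕[1⊖] α₁∈ α₂∈)) (proj₁ β∈))
                (cong (λ t → (t ⊕ (1 ∷ [])) ⊖ C) (P-⊕[1⊖] (proj₁ α₁∈) (proj₁ α₂∈)))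

    Pσ∌Pπ : 1 ≤ length α₁ → ¬ Contains (P π) (P σ)
    Pσ∌Pπ 1≤|α₁| Pσ∋Pπ = no-Peak-nested (subst (1 ≤_) (sym (length-P α₁)) 1≤|α₁|) (perm-P α₁) (perm-P α₂) (perm-P β)
      (subst (λ t → Peak t _ _) Pσ≡ (Peak-contains Pσ∋Pπ (subst (λ t → Peak t _ _) (sym Pπ≡)
        (Peak-[⊕1]⊖ (perm-⊖ (perm-⊕ (perm-P α₁) perm-1) (perm-P α₂)) (perm-P β)))))

    no-preimage : ¬ (∃ λ σ′ → Av (p231 ∷ π ∷ []) σ′ × P σ′ ≡ P σ)
    no-preimage (σ′ , (pσ′ , σ′∌231 ∷ σ′∌π ∷ []) , Pσ′≡Pσ) =
      σ′∌π (subst (Contains π) (sym (P-injective (pσ′ , σ′∌231 ∷ []) σ∈ Pσ′≡Pσ)) σ∋π)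

  not-restricts : 1 ≤ length α₁ → ¬ RestrictsToBijection π
  not-restricts 1≤|α₁| (_ , onto) = no-preimage (onto (P σ) (perm-P σ , P-avoids132 σ ∷ Pσ∌Pπ 1≤|α₁| ∷ []))

mainTheorem17 : (α β : List ℕ) → Av (p231 ∷ []) α → Av (p231 ∷ []) β →
                  RestrictsToBijection (α ⊕ ((1 ∷ []) ⊖ β)) → BeginsWithMax α
mainTheorem17 []      β _  _  _ = inj₁ refl
mainTheorem17 (x ∷ α) β α∈ β∈ restricts with decompose refl α∈
... | decomposition []        α₂ refl _   (pα₂ , _) = inj₂ (_ , _ , refl ,
  All.map⁺ (All.map (λ y≤ → +-monoˡ-≤ 0 (≤-trans y≤ (n≤1+n _))) (perm-≤-length pα₂)))
... | decomposition (y ∷ α₁) α₂ refl α₁∈ α₂∈      = ⊥-elim (not-restricts α₁∈ α₂∈ β∈ (s≤s z≤n) restricts)
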